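{- Let $G$ be a digraph, $S,T\subseteq V(G)$ disjoint and $k$ a nonnegative integer. If $G$ has a gapless $S$--$T$ chain of order at most $k$, then it has a tight, nice, and gapless $S$--$T$ chain of order at most $k$.
   Context: For $v\in V(G)$, $N^\pm(v)$ is its set of out-/in-neighbors, $N^\pm[v]=N^\pm(v)\cup\{v\}$, $N^\pm[U]=\bigcup_{v\in U}N^\pm[v]$. A separation of $G$ is a pair $(A,B)$ with $A\cup B=V(G)$ and no edge from $A\setminus B$ to $B\setminus A$; its order is $|A\cap B|$. A separation chain is a sequence $C=((A_0,B_0),\dots,(A_r,B_r))$ of separations with $A_0\subseteq\dots\subseteq A_r$, $B_r\subseteq\dots\subseteq B_0$; its order is the maximum order of its members; it is gapless if for every $0<i\le r$, $|A_i\setminus A_{i-1}|\le1$ or $|B_{i-1}\setminus B_i|\le1$; it is an $S$--$T$ chain if $B_0=V(G)\setminus S$ and $A_r=V(G)\setminus T$. An $S$--$T$ chain $C$ is nice if for every $0\le i<r$, $|A_{i+1}\setminus A_i|\le 1$ and $|B_i\setminus B_{i+1}|\le 1$; it is tight if $A_0=N^+[S]$ and $B_r=N^-[T]$. -}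

module Defs where

open import Data.Nat using (ℕ; suc; _≤_)
open import Data.Bool using (Bool; true; false)
open import Data.Fin using (Fin; zero; suc; inject₁; fromℕ)
open import Data.Fin.Subset using (Subset; _∈_; _∉_; _⊆_; _∩_; _─_; ∁; ∣_∣)
open import Data.Product using (Σ; _×_; ∃)
open import Data.Sum using (_⊎_)
open import Relation.Binary.PropositionalEquality using (_≡_)
open import Function.Bundles using (_⇔_)

record Digraph : Set where
  field
    n   : ℕ
    adj : Fin n → Fin n → Bool
open Digraph public

V : (G : Digraph) → Set
V G = Fin (n G)

VSet : (G : Digraph) → Set
VSet G = Subset (n G)

Disjoint : (G : Digraph) → VSet G → VSet G → Set
Disjoint G S T = ∀ (v : V G) → v ∈ S → v ∉ T

InOutNbhd : (G : Digraph) → VSet G → V G → Set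
InOutNbhd G U v = v ∈ U ⊎ Σ (V G) (λ u → u ∈ U × adj G u v ≡ true)

InInNbhd : (G : Digraph) → VSet G → V G → Set
InInNbhd G U v = v ∈ U ⊎ Σ (V G) (λ u → u ∈ U × adj G v u ≡ true)

IsSeparation : (G : Digraph) → VSet G → VSet G → Set
IsSeparation G A B =
  (∀ (v : V G) → v ∈ A ⊎ v ∈ B) ×
  (∀ (u v : V G) → u ∈ A ─ B → v ∈ B ─ A → adj G u v ≡ false)

order : (G : Digraph) → VSet G → VSet G → ℕ
order G A B = ∣ A ∩ B ∣

record SepChain (G : Digraph) : Set where
  field
    r    : ℕ
    A    : Fin (suc r) → VSet G
    B    : Fin (suc r) → VSet G
    isSep : ∀ (i : Fin (suc r)) → IsSeparation G (A i) (B i)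
    A-mono : ∀ (i : Fin r) → A (inject₁ i) ⊆ A (suc i)
    B-mono : ∀ (i : Fin r) → B (suc i) ⊆ B (inject₁ i)
open SepChain public

OrderAtMost : (G : Digraph) → SepChain G → ℕ → Set
OrderAtMost G C k = ∀ (i : Fin (suc (r C))) → order G (A C i) (B C i) ≤ k

Gapless : (G : Digraph) → SepChain G → Set
Gapless G C = ∀ (i : Fin (r C)) →
  ∣ A C (suc i) ─ A C (inject₁ i) ∣ ≤ 1 ⊎ ∣ B C (inject₁ i) ─ B C (suc i) ∣ ≤ 1

IsSTChain : (G : Digraph) → VSet G → VSet G → SepChain G → Set
IsSTChain G S T C = B C zero ≡ ∁ S × A C (fromℕ (r C)) ≡ ∁ T

Nice : (G : Digraph) → SepChain G → Set
Nice G C = ∀ (i : Fin (r C)) →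
  ∣ A C (suc i) ─ A C (inject₁ i) ∣ ≤ 1 × ∣ B C (inject₁ i) ─ B C (suc i) ∣ ≤ 1

Tight : (G : Digraph) → VSet G → VSet G → SepChain G → Set
Tight G S T C =
  (∀ (v : V G) → (v ∈ A C zero) ⇔ InOutNbhd G S v) ×
  (∀ (v : V G) → (v ∈ B C (fromℕ (r C))) ⇔ InInNbhd G T v)

-- A gapless chain is refined into a nice one gap by gap. Let (A , B), (A' , B') be consecutive
-- with |A' ─ A| ≤ 1 and pick d ∈ B ─ B'. Since (A' , B') covers V, d ∈ A', so the single step to
-- (A' , B - d) loses d from the intersection and gains at most the vertex of A' ─ A: its order
-- is at most that of (A , B). From there B - d shrinks to B' one vertex at a time with A' fixed,
-- and every intermediate order is bounded by |A' ∩ (B - d)|. Reversing all edges turns a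
-- separation (A , B) into (B , A) and a chain read backwards into a chain, so the case
-- |B ─ B'| ≤ 1 is the same argument in the reversed digraph.
-- For tightness, (N⁺[S] , V ∖ S) is a separation and N⁺[S] ⊆ A₀ whenever (A₀ , V ∖ S) is one;
-- growing N⁺[S] to A₀ one vertex at a time never exceeds the order of (A₀ , V ∖ S). The end at
-- T is symmetric.

module Submission where

open import Defs
open import Data.Nat using (ℕ; zero; suc; _≤_; z≤n; s≤s; s≤s⁻¹; _+_)
open import Data.Nat.Properties using (≤-trans; ≤-reflexive; +-mono-≤; +-suc; +-comm; module ≤-Reasoning)
open import Data.Bool using (Bool; true; false)
import Data.Bool as Bool
open import Data.Bool.Properties using (¬-not)
open import Data.Fin using (Fin; zero; suc; fromℕ; inject₁; _≟_)
open import Data.Fin.Properties using (any?)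
open import Data.Fin.Subset using (Subset; inside; outside; _∈_; _∉_; _⊆_; _∩_; _─_; _-_; ⁅_⁆; ∁; ∣_∣; Empty)
open import Data.Fin.Subset.Properties
  using ( s⊆s; out⊆; drop-∷-⊆; ⊆-refl; p⊆q⇒∣p∣≤∣q∣; x∈p∩q⁺; x∈p∩q⁻; ∩-comm; x∈p∧x∉q⇒x∈p─q
        ; p─q⊆p; x∈p∧x≢y⇒x∈p-y; x∈p⇒∣p-x∣<∣p∣; x∈⁅x⁆; ∣⁅x⁆∣≡1; nonempty?
        ; Empty-unique; ∣⊥∣≡0; _∈?_; x∈∁p⇒x∉p; x∉∁p⇒x∈p; x∉p⇒x∈∁p)
open import Data.Vec.Base using ([]; _∷_; here; there; tabulate)
import Data.Vec.Functional as Vector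
open import Data.Vec.Properties using ([]=⇒lookup; lookup⇒[]=; lookup∘tabulate)
open import Data.Product using (Σ; _×_; _,_; proj₁; proj₂)
open import Data.Sum using (_⊎_; inj₁; inj₂)
import Data.Sum as Sum
open import Data.Empty using (⊥-elim)
open import Relation.Nullary using (Dec; yes; no; does; contradiction; _×-dec_; _⊎-dec_)
open import Relation.Binary.PropositionalEquality using (_≡_; _≢_; refl; sym; trans; subst; subst₂; cong)
open import Function.Bundles using (_⇔_; mk⇔; Equivalence)
import Function.Properties.Equivalence as ⇔

x∈p─q⁻ : ∀ {m} (p q : Subset m) {x} → x ∈ p ─ q → x ∈ p × x ∉ q
x∈p─q⁻ (inside ∷ p) (outside ∷ q) {zero} here = here , λ ()
x∈p─q⁻ (outside ∷ p) (outside ∷ q) {zero} ()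
x∈p─q⁻ (_ ∷ p) (inside ∷ q) {zero} ()
x∈p─q⁻ (_ ∷ p) (_ ∷ q) {suc x} (there x∈) with x∈p─q⁻ p q x∈
... | x∈p , x∉q = there x∈p , λ { (there x∈q) → x∉q x∈q }

∣p∣≤∣p∩q∣+∣p─q∣ : ∀ {m} (p q : Subset m) → ∣ p ∣ ≤ ∣ p ∩ q ∣ + ∣ p ─ q ∣
∣p∣≤∣p∩q∣+∣p─q∣ [] [] = z≤n
∣p∣≤∣p∩q∣+∣p─q∣ (inside ∷ p) (inside ∷ q) = s≤s (∣p∣≤∣p∩q∣+∣p─q∣ p q)
∣p∣≤∣p∩q∣+∣p─q∣ (inside ∷ p) (outside ∷ q) =
  ≤-trans (s≤s (∣p∣≤∣p∩q∣+∣p─q∣ p q)) (≤-reflexive (sym (+-suc _ _)))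
∣p∣≤∣p∩q∣+∣p─q∣ (outside ∷ p) (inside ∷ q) = ∣p∣≤∣p∩q∣+∣p─q∣ p q
∣p∣≤∣p∩q∣+∣p─q∣ (outside ∷ p) (outside ∷ q) = ∣p∣≤∣p∩q∣+∣p─q∣ p q

x∈p-y⁻ : ∀ {m} {p : Subset m} {x y} → x ∈ p - y → x ∈ p × x ≢ y
x∈p-y⁻ {p = p} {y = y} x∈ with x∈p─q⁻ p ⁅ y ⁆ x∈
... | x∈p , x∉⁅y⁆ = x∈p , λ { refl → x∉⁅y⁆ (x∈⁅x⁆ y) }

∣p─p∣≡0 : ∀ {m} (p : Subset m) → ∣ p ─ p ∣ ≡ 0
∣p─p∣≡0 [] = refl
∣p─p∣≡0 (inside ∷ p) = ∣p─p∣≡0 p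
∣p─p∣≡0 (outside ∷ p) = ∣p─p∣≡0 p

∣p─p∣≤1 : ∀ {m} (p : Subset m) → ∣ p ─ p ∣ ≤ 1
∣p─p∣≤1 p = ≤-trans (≤-reflexive (∣p─p∣≡0 p)) z≤n

∣x∷p─x∷q∣≡∣p─q∣ : ∀ {m} x (p q : Subset m) → ∣ (x ∷ p) ─ (x ∷ q) ∣ ≡ ∣ p ─ q ∣
∣x∷p─x∷q∣≡∣p─q∣ inside p q = refl
∣x∷p─x∷q∣≡∣p─q∣ outside p q = refl

∣y∷p─x∷p∣≤1 : ∀ {m} x y (p : Subset m) → ∣ (y ∷ p) ─ (x ∷ p) ∣ ≤ 1
∣y∷p─x∷p∣≤1 outside inside p = s≤s (≤-reflexive (∣p─p∣≡0 p))
∣y∷p─x∷p∣≤1 inside inside p = ∣p─p∣≤1 p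
∣y∷p─x∷p∣≤1 inside outside p = ∣p─p∣≤1 p
∣y∷p─x∷p∣≤1 outside outside p = ∣p─p∣≤1 p

∣p─[p-x]∣≤1 : ∀ {m} (p : Subset m) x → ∣ p ─ (p - x) ∣ ≤ 1
∣p─[p-x]∣≤1 p x = subst (∣ p ─ (p - x) ∣ ≤_) (∣⁅x⁆∣≡1 x) (p⊆q⇒∣p∣≤∣q∣ p─[p-x]⊆⁅x⁆)
  where
  p─[p-x]⊆⁅x⁆ : p ─ (p - x) ⊆ ⁅ x ⁆
  p─[p-x]⊆⁅x⁆ {y} y∈ with x∈p─q⁻ p (p - x) y∈
  ... | y∈p , y∉p-x with y ≟ x
  ...   | yes refl = x∈⁅x⁆ x
  ...   | no y≢x = ⊥-elim (y∉p-x (x∈p∧x≢y⇒x∈p-y y∈p y≢x))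

Empty⇒∣p∣≡0 : ∀ {m} {p : Subset m} → Empty p → ∣ p ∣ ≡ 0
Empty⇒∣p∣≡0 {m} p-empty rewrite Empty-unique p-empty = ∣⊥∣≡0 m

x∷p⊆y∷q⇒x∷r⊆y∷s : ∀ {m} {x y} {p q r s : Subset m} → x ∷ p ⊆ y ∷ q → r ⊆ s → x ∷ r ⊆ y ∷ s
x∷p⊆y∷q⇒x∷r⊆y∷s {x = outside} _ r⊆s = out⊆ r⊆s
x∷p⊆y∷q⇒x∷r⊆y∷s {x = inside} {inside} _ r⊆s = s⊆s r⊆s
x∷p⊆y∷q⇒x∷r⊆y∷s {x = inside} {outside} x∷p⊆y∷q with x∷p⊆y∷q here
... | ()

∣p∩[q-x]∣≤∣r∩q∣ : ∀ {m} {p q r : Subset m} {x} → x ∈ p → x ∈ q → ∣ p ─ r ∣ ≤ 1 →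
  ∣ p ∩ (q - x) ∣ ≤ ∣ r ∩ q ∣
∣p∩[q-x]∣≤∣r∩q∣ {p = p} {q} {r} {x} x∈p x∈q ∣p─r∣≤1 = s≤s⁻¹ (begin
  suc ∣ p ∩ (q - x) ∣                ≤⟨ s≤s (p⊆q⇒∣p∣≤∣q∣ p∩[q-x]⊆[p∩q]-x) ⟩
  suc ∣ (p ∩ q) - x ∣                ≤⟨ x∈p⇒∣p-x∣<∣p∣ (x∈p∩q⁺ (x∈p , x∈q)) ⟩
  ∣ p ∩ q ∣                          ≤⟨ ∣p∣≤∣p∩q∣+∣p─q∣ (p ∩ q) r ⟩
  ∣ (p ∩ q) ∩ r ∣ + ∣ (p ∩ q) ─ r ∣  ≤⟨ +-mono-≤ (p⊆q⇒∣p∣≤∣q∣ [p∩q]∩r⊆r∩q)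
                                                  (≤-trans (p⊆q⇒∣p∣≤∣q∣ [p∩q]─r⊆p─r) ∣p─r∣≤1) ⟩
  ∣ r ∩ q ∣ + 1                      ≡⟨ +-comm _ 1 ⟩
  suc ∣ r ∩ q ∣                      ∎)
  where
  open ≤-Reasoning
  p∩[q-x]⊆[p∩q]-x : p ∩ (q - x) ⊆ (p ∩ q) - x
  p∩[q-x]⊆[p∩q]-x y∈ with x∈p∩q⁻ p (q - x) y∈
  ... | y∈p , y∈q-x with x∈p-y⁻ y∈q-x
  ...   | y∈q , y≢x = x∈p∧x≢y⇒x∈p-y (x∈p∩q⁺ (y∈p , y∈q)) y≢x
  [p∩q]∩r⊆r∩q : (p ∩ q) ∩ r ⊆ r ∩ q
  [p∩q]∩r⊆r∩q y∈ with x∈p∩q⁻ (p ∩ q) r y∈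
  ... | y∈p∩q , y∈r = x∈p∩q⁺ (y∈r , proj₂ (x∈p∩q⁻ p q y∈p∩q))
  [p∩q]─r⊆p─r : (p ∩ q) ─ r ⊆ p ─ r
  [p∩q]─r⊆p─r y∈ with x∈p─q⁻ (p ∩ q) r y∈
  ... | y∈p∩q , y∉r = x∈p∧x∉q⇒x∈p─q (proj₁ (x∈p∩q⁻ p q y∈p∩q)) y∉r

p⊆q⇒∣p∩r∣≤∣q∩r∣ : ∀ {m} {p q : Subset m} (r : Subset m) → p ⊆ q → ∣ p ∩ r ∣ ≤ ∣ q ∩ r ∣
p⊆q⇒∣p∩r∣≤∣q∩r∣ {p = p} r p⊆q = p⊆q⇒∣p∣≤∣q∣ λ x∈ →
  let x∈p , x∈r = x∈p∩q⁻ p r x∈ in x∈p∩q⁺ (p⊆q x∈p , x∈r)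

NiceStep : ∀ {m} (P Q P' Q' : Subset m) → Set
NiceStep P Q P' Q' = P ⊆ P' × Q' ⊆ Q × ∣ P' ─ P ∣ ≤ 1 × ∣ Q ─ Q' ∣ ≤ 1

flip-step : ∀ {m} {P Q P' Q' : Subset m} → NiceStep P Q P' Q' → NiceStep Q' P' Q P
flip-step (P⊆P' , Q'⊆Q , ∣P'─P∣≤1 , ∣Q─Q'∣≤1) = Q'⊆Q , P⊆P' , ∣Q─Q'∣≤1 , ∣P'─P∣≤1

cons-step : ∀ {m} x y {P Q P' Q' : Subset m} → NiceStep P Q P' Q' → NiceStep (x ∷ P) (y ∷ Q) (x ∷ P') (y ∷ Q')
cons-step x y {P} {Q} {P'} {Q'} (P⊆P' , Q'⊆Q , ∣P'─P∣≤1 , ∣Q─Q'∣≤1) =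
  s⊆s P⊆P' , s⊆s Q'⊆Q ,
  subst (_≤ 1) (sym (∣x∷p─x∷q∣≡∣p─q∣ x P' P)) ∣P'─P∣≤1 ,
  subst (_≤ 1) (sym (∣x∷p─x∷q∣≡∣p─q∣ y Q Q')) ∣Q─Q'∣≤1

data NicePath {m} (R : Subset m → Subset m → Set) : (P Q P' Q' : Subset m) → Set where
  [_]    : ∀ {P Q} → R P Q → NicePath R P Q P Q
  _∷⟨_⟩_ : ∀ {P Q P₁ Q₁ P' Q'} → R P Q → NiceStep P Q P₁ Q₁ → NicePath R P₁ Q₁ P' Q' →
           NicePath R P Q P' Q'

infixr 5 _∷⟨_⟩_ _++_

_++_ : ∀ {m} {R : Subset m → Subset m → Set} {P Q P₁ Q₁ P' Q'} →
  NicePath R P Q P₁ Q₁ → NicePath R P₁ Q₁ P' Q' → NicePath R P Q P' Q'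
[ _ ] ++ path = path
(r ∷⟨ step ⟩ path₁) ++ path = r ∷⟨ step ⟩ (path₁ ++ path)

snoc : ∀ {m} {R : Subset m → Subset m → Set} {P Q P₁ Q₁ P' Q'} →
  NicePath R P Q P₁ Q₁ → NiceStep P₁ Q₁ P' Q' → R P' Q' → NicePath R P Q P' Q'
snoc [ r ] step r' = r ∷⟨ step ⟩ [ r' ]
snoc (r ∷⟨ step₁ ⟩ path) step r' = r ∷⟨ step₁ ⟩ snoc path step r'

reverse : ∀ {m} {R R' : Subset m → Subset m → Set} → (∀ {P Q} → R P Q → R' Q P) →
  ∀ {P Q P' Q'} → NicePath R P Q P' Q' → NicePath R' Q' P' Q P
reverse f [ r ] = [ f r ]
reverse f (r ∷⟨ step ⟩ path) = snoc (reverse f path) (flip-step step) (f r)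

cons-path : ∀ {m} {R : Subset (suc m) → Subset (suc m) → Set} x y {P Q P' Q'} →
  NicePath (λ X Y → R (x ∷ X) (y ∷ Y)) P Q P' Q' → NicePath R (x ∷ P) (y ∷ Q) (x ∷ P') (y ∷ Q')
cons-path x y [ r ] = [ r ]
cons-path x y (r ∷⟨ step ⟩ path) = r ∷⟨ cons-step x y step ⟩ cons-path x y path

ascend : ∀ {m} {R : Subset m → Subset m → Set} {P P'} (Q : Subset m) → P ⊆ P' →
  (∀ {X} → P ⊆ X → X ⊆ P' → R X Q) → NicePath R P Q P' Q
ascend {P = []} {[]} [] _ R-between = [ R-between ⊆-refl ⊆-refl ]
ascend {P = x ∷ P} {x' ∷ P'} (y ∷ Q) x∷P⊆x'∷P' R-between =
  R-between ⊆-refl x∷P⊆x'∷P'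
    ∷⟨ x∷p⊆y∷q⇒x∷r⊆y∷s x∷P⊆x'∷P' ⊆-refl , ⊆-refl , ∣y∷p─x∷p∣≤1 x x' P , ∣p─p∣≤1 (y ∷ Q) ⟩
  cons-path x' y (ascend Q (drop-∷-⊆ x∷P⊆x'∷P')
    λ P⊆X X⊆P' → R-between (x∷p⊆y∷q⇒x∷r⊆y∷s x∷P⊆x'∷P' P⊆X) (s⊆s X⊆P'))

_ᵒᵖ : Digraph → Digraph
G ᵒᵖ = record { n = n G ; adj = λ u v → adj G v u }

SepAtMost : (G : Digraph) → ℕ → VSet G → VSet G → Set
SepAtMost G k A B = IsSeparation G A B × order G A B ≤ k

IsSeparation-ᵒᵖ : ∀ {G A B} → IsSeparation G A B → IsSeparation (G ᵒᵖ) B A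
IsSeparation-ᵒᵖ (covers , no-edge) = (λ v → Sum.swap (covers v)) , λ u v u∈ v∈ → no-edge v u v∈ u∈

order-ᵒᵖ : ∀ G (A B : VSet G) → order (G ᵒᵖ) B A ≡ order G A B
order-ᵒᵖ G A B = cong ∣_∣ (∩-comm B A)

SepAtMost-ᵒᵖ : ∀ {G k A B} → SepAtMost G k A B → SepAtMost (G ᵒᵖ) k B A
SepAtMost-ᵒᵖ {G} {A = A} {B} (sep , o) = IsSeparation-ᵒᵖ sep , subst (_≤ _) (sym (order-ᵒᵖ G A B)) o

sep-⊆ˡ : ∀ {G A A' B} → IsSeparation G A B → A ⊆ A' → IsSeparation G A' B
sep-⊆ˡ {G} {A} {A'} {B} (covers , no-edge) A⊆A' =
  (λ v → Sum.map₁ A⊆A' (covers v)) , λ u v u∈ v∈ → no-edge u v (shrink-source u∈) (shrink-sink v∈)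
  where
  shrink-source : ∀ {u} → u ∈ A' ─ B → u ∈ A ─ B
  shrink-source {u} u∈ with x∈p─q⁻ A' B u∈ | covers u
  ... | _ , u∉B | inj₁ u∈A = x∈p∧x∉q⇒x∈p─q u∈A u∉B
  ... | _ , u∉B | inj₂ u∈B = ⊥-elim (u∉B u∈B)
  shrink-sink : ∀ {v} → v ∈ B ─ A' → v ∈ B ─ A
  shrink-sink v∈ with x∈p─q⁻ B A' v∈
  ... | v∈B , v∉A' = x∈p∧x∉q⇒x∈p─q v∈B (λ v∈A → v∉A' (A⊆A' v∈A))

raiseˡ : ∀ {G k A A' B} → IsSeparation G A B → A ⊆ A' → order G A' B ≤ k →
  NicePath (SepAtMost G k) A B A' B
raiseˡ {B = B} sep A⊆A' o =
  ascend B A⊆A' λ A⊆X X⊆A' → sep-⊆ˡ sep A⊆X , ≤-trans (p⊆q⇒∣p∩r∣≤∣q∩r∣ B X⊆A') o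

lowerʳ : ∀ {G k A B B'} → IsSeparation G A B' → B' ⊆ B → order G A B ≤ k →
  NicePath (SepAtMost G k) A B A B'
lowerʳ {G} {A = A} {B} sep B'⊆B o =
  reverse SepAtMost-ᵒᵖ (raiseˡ (IsSeparation-ᵒᵖ sep) B'⊆B (subst (_≤ _) (sym (order-ᵒᵖ G A B)) o))

gapˡ : ∀ {G k A B A' B'} → SepAtMost G k A B → SepAtMost G k A' B' → A ⊆ A' → B' ⊆ B →
  ∣ A' ─ A ∣ ≤ 1 → NicePath (SepAtMost G k) A B A' B'
gapˡ {B = B} {A' = A'} {B' = B'} small small' A⊆A' B'⊆B ∣A'─A∣≤1 with nonempty? (B ─ B')
... | no B─B'-empty =
  small ∷⟨ A⊆A' , B'⊆B , ∣A'─A∣≤1 , ≤-trans (≤-reflexive (Empty⇒∣p∣≡0 B─B'-empty)) z≤n ⟩ [ small' ]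
... | yes (d , d∈B─B') =
  small ∷⟨ A⊆A' , p─q⊆p B ⁅ d ⁆ , ∣A'─A∣≤1 , ∣p─[p-x]∣≤1 B d ⟩
  lowerʳ (proj₁ small') B'⊆B-d (≤-trans (∣p∩[q-x]∣≤∣r∩q∣ d∈A' d∈B ∣A'─A∣≤1) (proj₂ small))
  where
  d∈B : d ∈ B
  d∈B = proj₁ (x∈p─q⁻ B B' d∈B─B')
  d∉B' : d ∉ B'
  d∉B' = proj₂ (x∈p─q⁻ B B' d∈B─B')
  d∈A' : d ∈ A'
  d∈A' = Sum.fromInj₁ (λ d∈B' → ⊥-elim (d∉B' d∈B')) (proj₁ (proj₁ small') d)
  B'⊆B-d : B' ⊆ B - d
  B'⊆B-d v∈B' = x∈p∧x≢y⇒x∈p-y (B'⊆B v∈B') λ { refl → d∉B' v∈B' }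

gapʳ : ∀ {G k A B A' B'} → SepAtMost G k A B → SepAtMost G k A' B' → A ⊆ A' → B' ⊆ B →
  ∣ B ─ B' ∣ ≤ 1 → NicePath (SepAtMost G k) A B A' B'
gapʳ small small' A⊆A' B'⊆B ∣B─B'∣≤1 =
  reverse SepAtMost-ᵒᵖ (gapˡ (SepAtMost-ᵒᵖ small') (SepAtMost-ᵒᵖ small) B'⊆B A⊆A' ∣B─B'∣≤1)

GaplessStep : ∀ {m} (P Q P' Q' : Subset m) → Set
GaplessStep P Q P' Q' = P ⊆ P' × Q' ⊆ Q × (∣ P' ─ P ∣ ≤ 1 ⊎ ∣ Q ─ Q' ∣ ≤ 1)

gap : ∀ {G k A B A' B'} → SepAtMost G k A B → SepAtMost G k A' B' → GaplessStep A B A' B' →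
  NicePath (SepAtMost G k) A B A' B'
gap small small' (A⊆A' , B'⊆B , ∣A'─A∣≤1⊎∣B─B'∣≤1) =
  Sum.[ gapˡ small small' A⊆A' B'⊆B , gapʳ small small' A⊆A' B'⊆B ] ∣A'─A∣≤1⊎∣B─B'∣≤1

gapless⇒nicePath : ∀ {G k} r (A B : Fin (suc r) → VSet G) → (∀ i → SepAtMost G k (A i) (B i)) →
  (∀ (i : Fin r) → GaplessStep (A (inject₁ i)) (B (inject₁ i)) (A (suc i)) (B (suc i))) →
  NicePath (SepAtMost G k) (A zero) (B zero) (A (fromℕ r)) (B (fromℕ r))
gapless⇒nicePath zero A B small _ = [ small zero ]
gapless⇒nicePath (suc r) A B small steps =
  gap (small zero) (small (suc zero)) (steps zero) ++
  gapless⇒nicePath r (λ i → A (suc i)) (λ i → B (suc i)) (λ i → small (suc i)) (λ i → steps (suc i))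

Joins : ∀ {G} → SepChain G → (P Q P' Q' : VSet G) → Set
Joins C P Q P' Q' = (A C zero ≡ P × B C zero ≡ Q) × (A C (fromℕ (r C)) ≡ P' × B C (fromℕ (r C)) ≡ Q')

nicePath⇒chain : ∀ {G k P Q P' Q'} → NicePath (SepAtMost G k) P Q P' Q' →
  Σ (SepChain G) λ C → Joins C P Q P' Q' × Nice G C × OrderAtMost G C k
nicePath⇒chain {P = P} {Q} [ sep , o ] =
  record { r = 0 ; A = λ _ → P ; B = λ _ → Q ; isSep = λ _ → sep ; A-mono = λ () ; B-mono = λ () } ,
  ((refl , refl) , (refl , refl)) , (λ ()) , λ _ → o
nicePath⇒chain {G} {k} {P} {Q} ((sep , o) ∷⟨ P⊆P₁ , Q₁⊆Q , ∣P₁─P∣≤1 , ∣Q─Q₁∣≤1 ⟩ path)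
  with nicePath⇒chain path
... | C , ((A₀≡P₁ , B₀≡Q₁) , ends) , nice , small = C' , ((refl , refl) , ends) , nice' , small'
  where
  C' : SepChain G
  C' = record
    { r = suc (r C) ; A = P Vector.∷ A C ; B = Q Vector.∷ B C
    ; isSep = λ { zero → sep ; (suc i) → isSep C i }
    ; A-mono = λ { zero → subst (P ⊆_) (sym A₀≡P₁) P⊆P₁ ; (suc i) → A-mono C i }
    ; B-mono = λ { zero → subst (_⊆ Q) (sym B₀≡Q₁) Q₁⊆Q ; (suc i) → B-mono C i } }
  nice' : Nice G C'
  nice' zero = subst (λ X → ∣ X ─ P ∣ ≤ 1) (sym A₀≡P₁) ∣P₁─P∣≤1
             , subst (λ X → ∣ Q ─ X ∣ ≤ 1) (sym B₀≡Q₁) ∣Q─Q₁∣≤1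
  nice' (suc i) = nice i
  small' : OrderAtMost G C' k
  small' zero = o
  small' (suc i) = small i

∈-tabulate⇔ : ∀ {m} (f : Fin m → Bool) {v} → v ∈ tabulate f ⇔ f v ≡ true
∈-tabulate⇔ f {v} = mk⇔
  (λ v∈ → trans (sym (lookup∘tabulate f v)) ([]=⇒lookup v∈))
  (λ fv≡true → lookup⇒[]= v (tabulate f) (trans (lookup∘tabulate f v) fv≡true))

does≡true⇔ : ∀ {P : Set} (P? : Dec P) → does P? ≡ true ⇔ P
does≡true⇔ (yes p) = mk⇔ (λ _ → p) (λ _ → refl)
does≡true⇔ (no ¬p) = mk⇔ (λ ()) (λ p → ⊥-elim (¬p p))

InOutNbhd? : ∀ G (S : VSet G) v → Dec (InOutNbhd G S v)
InOutNbhd? G S v = (v ∈? S) ⊎-dec any? λ u → (u ∈? S) ×-dec (adj G u v Bool.≟ true)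

N⁺ : (G : Digraph) → VSet G → VSet G
N⁺ G S = tabulate λ v → does (InOutNbhd? G S v)

N⁻ : (G : Digraph) → VSet G → VSet G
N⁻ G = N⁺ (G ᵒᵖ)

∈N⁺⇔ : ∀ {G S v} → v ∈ N⁺ G S ⇔ InOutNbhd G S v
∈N⁺⇔ {G} {S} {v} = ⇔.trans (∈-tabulate⇔ _) (does≡true⇔ (InOutNbhd? G S v))

∈N⁻⇔ : ∀ {G T v} → v ∈ N⁻ G T ⇔ InInNbhd G T v
∈N⁻⇔ {G} = ∈N⁺⇔ {G ᵒᵖ}

N⁺-sep : ∀ G (S : VSet G) → IsSeparation G (N⁺ G S) (∁ S)
N⁺-sep G S = covers , no-edge
  where
  covers : ∀ v → v ∈ N⁺ G S ⊎ v ∈ ∁ S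
  covers v with v ∈? S
  ... | yes v∈S = inj₁ (Equivalence.from ∈N⁺⇔ (inj₁ v∈S))
  ... | no v∉S = inj₂ (x∉p⇒x∈∁p v∉S)
  no-edge : ∀ u v → u ∈ N⁺ G S ─ ∁ S → v ∈ ∁ S ─ N⁺ G S → adj G u v ≡ false
  no-edge u v u∈ v∈ = ¬-not λ uv-edge → proj₂ (x∈p─q⁻ (∁ S) _ v∈)
    (Equivalence.from ∈N⁺⇔ (inj₂ (u , x∉∁p⇒x∈p (proj₂ (x∈p─q⁻ _ (∁ S) u∈)) , uv-edge)))

sep-∁⇒⊆ : ∀ {G A S} → IsSeparation G A (∁ S) → S ⊆ A
sep-∁⇒⊆ (covers , _) {u} u∈S = Sum.fromInj₁ (λ u∈∁S → ⊥-elim (x∈∁p⇒x∉p u∈∁S u∈S)) (covers u)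

N⁺-minimal : ∀ {G S A} → IsSeparation G A (∁ S) → N⁺ G S ⊆ A
N⁺-minimal {G} {S} {A} sep {v} v∈N⁺ with Equivalence.to ∈N⁺⇔ v∈N⁺
... | inj₁ v∈S = sep-∁⇒⊆ sep v∈S
... | inj₂ (u , u∈S , uv-edge) with v ∈? A
...   | yes v∈A = v∈A
...   | no v∉A = contradiction (trans (sym uv-edge) (proj₂ sep u v u∈A─∁S v∈∁S─A)) λ ()
  where
  u∈A─∁S : u ∈ A ─ ∁ S
  u∈A─∁S = x∈p∧x∉q⇒x∈p─q (sep-∁⇒⊆ sep u∈S) (λ u∈∁S → x∈∁p⇒x∉p u∈∁S u∈S)
  v∈∁S─A : v ∈ ∁ S ─ A
  v∈∁S─A = x∈p∧x∉q⇒x∈p─q (Sum.fromInj₂ (λ v∈A → ⊥-elim (v∉A v∈A)) (proj₁ sep v)) v∉A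

tighten-source : ∀ {G k S A} → SepAtMost G k A (∁ S) → NicePath (SepAtMost G k) (N⁺ G S) (∁ S) A (∁ S)
tighten-source {G} {S = S} (sep , o) = raiseˡ (N⁺-sep G S) (N⁺-minimal sep) o

tighten-sink : ∀ {G k T B} → SepAtMost G k (∁ T) B → NicePath (SepAtMost G k) (∁ T) B (∁ T) (N⁻ G T)
tighten-sink small = reverse SepAtMost-ᵒᵖ (tighten-source (SepAtMost-ᵒᵖ small))

gaplessChain⇒tightNicePath : ∀ {G S T k} →
  Σ (SepChain G) (λ C → IsSTChain G S T C × Gapless G C × OrderAtMost G C k) →
  NicePath (SepAtMost G k) (N⁺ G S) (∁ S) (∁ T) (N⁻ G T)
gaplessChain⇒tightNicePath {G} {S} {T} {k} (C , (B₀≡∁S , Aᵣ≡∁T) , gapless , small) =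
  tighten-source first ++ middle ++ tighten-sink last
  where
  small-at : ∀ i → SepAtMost G k (A C i) (B C i)
  small-at i = isSep C i , small i
  first : SepAtMost G k (A C zero) (∁ S)
  first = subst (SepAtMost G k _) B₀≡∁S (small-at zero)
  last : SepAtMost G k (∁ T) (B C (fromℕ (r C)))
  last = subst (λ X → SepAtMost G k X _) Aᵣ≡∁T (small-at (fromℕ (r C)))
  middle : NicePath (SepAtMost G k) (A C zero) (∁ S) (∁ T) (B C (fromℕ (r C)))
  middle = subst₂ (λ Y X → NicePath _ _ Y X _) B₀≡∁S Aᵣ≡∁T
    (gapless⇒nicePath (r C) (A C) (B C) small-at λ i → A-mono C i , B-mono C i , gapless i)

lemma5 : (G : Digraph) (S T : VSet G) (k : ℕ) → Disjoint G S T →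
    Σ (SepChain G) (λ C → IsSTChain G S T C × Gapless G C × OrderAtMost G C k) →
    Σ (SepChain G) (λ C → IsSTChain G S T C × Tight G S T C × Nice G C × Gapless G C × OrderAtMost G C k)
lemma5 G S T k _ chain with nicePath⇒chain (gaplessChain⇒tightNicePath chain)
... | C , ((A₀≡N⁺ , B₀≡∁S) , (Aᵣ≡∁T , Bᵣ≡N⁻)) , nice , small =
  C , (B₀≡∁S , Aᵣ≡∁T) , tight , nice , (λ i → inj₁ (proj₁ (nice i))) , small
  where
  tight : Tight G S T C
  tight = (λ v → subst (λ X → v ∈ X ⇔ _) (sym A₀≡N⁺) ∈N⁺⇔)
        , (λ v → subst (λ X → v ∈ X ⇔ _) (sym Bᵣ≡N⁻) (∈N⁻⇔ {G}))
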